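{- Let $(D,X,H)$ be a minimal uncolorable degree-feasible configuration, and let $u,v\in V(D)$ be such that both $uv$ and $vu$ are arcs of $D$. Then $H[X_u\cup X_v]$ is bidirected, i.e. for every arc of $H[X_u\cup X_v]$ its opposite arc is also an arc of $H$.
   Context: Digraphs are finite, without loops and parallel arcs (opposite arcs allowed); connectivity means weak connectivity. A cover of a digraph $D$ is a pair $(X,H)$: pairwise disjoint sets $X_v$ ($v\in V(D)$), and a digraph $H$ on $\bigcup_v X_v$ with each $X_v$ independent, such that for each arc $uv\in A(D)$ the arcs of $H$ from $X_u$ to $X_v$ form a (possibly empty) matching and every arc of $H$ arises in this way. A feasible configuration is a triple $(D,X,H)$ with $D$ connected and $(X,H)$ a cover of $D$; degree-feasible means $|X_v|\ge\max\{d_D^+(v),d_D^-(v)\}$ for all $v$. An acyclic transversal is a set $T\subseteq V(H)$ with $|T\cap X_v|=1$ for all $v$ and $H[T]$ containing no directed cycle; the configuration is colorable if one exists, uncolorable otherwise, and minimal uncolorable if uncolorable but $(D,X,H-a)$ is colorable for every arc $a\in A(H)$. -}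

module Defs where

open import Data.Nat using (ℕ; zero; suc; _+_; _≤_; _⊔_)
open import Data.Fin using (Fin; zero; suc; inject₁; fromℕ; _≟_)
open import Data.Bool using (Bool; true; false; _∧_; not; if_then_else_)
open import Relation.Nullary.Decidable using (⌊_⌋)
open import Relation.Binary.PropositionalEquality using (_≡_; _≢_)
open import Data.Product using (Σ; _×_; ∃)
open import Data.Sum using (_⊎_)
open import Relation.Nullary using (¬_)
open import Function.Definitions using (Injective)

-- Using a Bool-valued relation makes parallel arcs impossible; opposite
-- arcs are allowed.  Looplessness is imposed separately where needed.
Digraph : ℕ → Set
Digraph n = Fin n → Fin n → Bool

Arc : ∀ {n} → Digraph n → Fin n → Fin n → Set
Arc D u v = D u v ≡ true

Loopless : ∀ {n} → Digraph n → Set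
Loopless D = ∀ v → D v v ≡ false

count : ∀ {n} → (Fin n → Bool) → ℕ
count {zero}  f = 0
count {suc n} f = (if f zero then 1 else 0) + count (λ i → f (suc i))

outdeg : ∀ {n} → Digraph n → Fin n → ℕ
outdeg D v = count (λ w → D v w)

indeg : ∀ {n} → Digraph n → Fin n → ℕ
indeg D v = count (λ w → D w v)

data UWalk {n} (D : Digraph n) : Fin n → Fin n → Set where
  here     : ∀ {u} → UWalk D u u
  forward  : ∀ {u w v} → Arc D u w → UWalk D w v → UWalk D u v
  backward : ∀ {u w v} → Arc D w u → UWalk D w v → UWalk D u v

WeaklyConnected : ∀ {n} → Digraph n → Set
WeaklyConnected D = ∀ u v → UWalk D u v

-- A cover of D.  The vertices of H are Fin m, and p x = v means x ∈ X_v;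
-- so the sets X_v = p⁻¹(v) are pairwise disjoint with union V(H).
record IsCover {n m} (D : Digraph n) (p : Fin m → Fin n) (H : Digraph m) : Set where
  field
    independent  : ∀ x y → Arc H x y → p x ≢ p y
    arises       : ∀ x y → Arc H x y → Arc D (p x) (p y)
    matching-out : ∀ x y y′ → Arc H x y → Arc H x y′ → p y ≡ p y′ → y ≡ y′
    matching-in  : ∀ x x′ y → Arc H x y → Arc H x′ y → p x ≡ p x′ → x ≡ x′

fiberSize : ∀ {n m} → (Fin m → Fin n) → Fin n → ℕ
fiberSize p v = count (λ x → ⌊ p x ≟ v ⌋)

FeasibleConfiguration : ∀ {n m} → Digraph n → (Fin m → Fin n) → Digraph m → Set
FeasibleConfiguration D p H = Loopless D × WeaklyConnected D × IsCover D p H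

DegreeFeasible : ∀ {n m} → Digraph n → (Fin m → Fin n) → Set
DegreeFeasible D p = ∀ v → outdeg D v ⊔ indeg D v ≤ fiberSize p v

induced : ∀ {m} → Digraph m → (Fin m → Bool) → Digraph m
induced H T x y = T x ∧ T y ∧ H x y

record DirectedCycle {m} (G : Digraph m) : Set where
  field
    len     : ℕ
    vert    : Fin (suc len) → Fin m
    distinct : Injective _≡_ _≡_ vert
    step    : ∀ (i : Fin len) → Arc G (vert (inject₁ i)) (vert (suc i))
    close   : Arc G (vert (fromℕ len)) (vert zero)

IsTransversal : ∀ {n m} → (Fin m → Fin n) → (Fin m → Bool) → Set
IsTransversal p T = ∀ v → count (λ x → T x ∧ ⌊ p x ≟ v ⌋) ≡ 1

AcyclicTransversal : ∀ {n m} → (Fin m → Fin n) → Digraph m → (Fin m → Bool) → Set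
AcyclicTransversal p H T = IsTransversal p T × ¬ DirectedCycle (induced H T)

Colorable : ∀ {n m} → (Fin m → Fin n) → Digraph m → Set
Colorable p H = ∃ (λ T → AcyclicTransversal p H T)

removeArc : ∀ {m} → Digraph m → Fin m → Fin m → Digraph m
removeArc H x y a b = H a b ∧ not (⌊ a ≟ x ⌋ ∧ ⌊ b ≟ y ⌋)

MinimalUncolorable : ∀ {n m} → (Fin m → Fin n) → Digraph m → Set
MinimalUncolorable p H =
  ¬ Colorable p H × (∀ x y → Arc H x y → Colorable p (removeArc H x y))

module Submission where

-- Suppose yx ∉ H, and let T be an acyclic transversal of H - xy (minimality);
-- x, y ∈ T since H has none.  For an endpoint z ∈ {x, y} and w ∈ X_{p z},
-- exchanging z for w in T yields a transversal of H, whose cycle must leave w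
-- towards some exit(w) ∈ T - z.  The matching property makes w ↦ p(exit w)
-- injective from X_{p z} into N⁺_D(p z), and degree feasibility (a counting
-- argument) makes it onto.  Hence each w ∈ X_{p z} has a unique out-neighbour
-- in T, and each t ∈ T over N⁺_D(p z) has an in-neighbour in X_{p z}.  For
-- z = y, t = x this gives y′ ∈ X_{p y} with y′x ∈ H; exchanging y for y′, the
-- resulting cycle runs y′ → x → c with c neither y′ (matching) nor in T (the
-- only out-neighbour of x in T is y) — a contradiction.

open import Defs
open import Data.Fin using (Fin)
open import Data.Sum using (_⊎_)
open import Relation.Binary.PropositionalEquality using (_≡_)

open import Data.Nat using (zero; suc; _+_; _≤_; z≤n; s≤s)
open import Data.Nat.Properties using (≤-trans; m≤m⊔n; 1+n≰n; 1+n≢0; +-suc; suc-injective)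
open import Data.Fin using (zero; suc; inject₁; fromℕ; _≟_)
open import Data.Fin.Properties using (any?; 0≢1+n) renaming (suc-injective to Fin-suc-injective)
open import Data.Bool using (Bool; true; false; _∧_; _∨_; not)
open import Data.Bool.Properties using (∧-identityʳ) renaming (_≟_ to _≟ᴮ_)
open import Relation.Nullary.Decidable using (Dec; yes; no; ⌊_⌋; ⌊⌋-map′; _×-dec_; ¬?; decidable-stable)
open import Relation.Binary.PropositionalEquality using (_≢_; refl; sym; trans; cong; subst; subst₂; module ≡-Reasoning)
open import Axiom.UniquenessOfIdentityProofs using (module Decidable⇒UIP)
open import Data.Product using (Σ; _×_; ∃; _,_; proj₁; proj₂)
open import Data.Sum using (inj₁; inj₂; [_,_]) renaming (map to ⊎-map)
open import Data.Empty using (⊥; ⊥-elim)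
open import Relation.Nullary using (¬_)
open import Function using (_∘_)

∧-elim : ∀ {a b} → a ∧ b ≡ true → a ≡ true × b ≡ true
∧-elim {true} {true} _ = refl , refl

∧-intro : ∀ {a b} → a ≡ true → b ≡ true → a ∧ b ≡ true
∧-intro refl refl = refl

∨-elim : ∀ {a b} → a ∨ b ≡ true → a ≡ true ⊎ b ≡ true
∨-elim {true}  _  = inj₁ refl
∨-elim {false} eq = inj₂ eq

∨-introʳ : ∀ {a b} → b ≡ true → a ∨ b ≡ true
∨-introʳ {true}  _  = refl
∨-introʳ {false} eq = eq

⌊⌋-sound : ∀ {P : Set} (d : Dec P) → ⌊ d ⌋ ≡ true → P
⌊⌋-sound (yes p) _ = p

⌊⌋-refutes : ∀ {P : Set} (d : Dec P) → not ⌊ d ⌋ ≡ true → ¬ P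
⌊⌋-refutes (no ¬p) _ = ¬p

⌊⌋-complete : ∀ {P : Set} (d : Dec P) → P → ⌊ d ⌋ ≡ true
⌊⌋-complete (yes _) _ = refl
⌊⌋-complete (no ¬p) p = ⊥-elim (¬p p)

⌊⌋-complete-¬ : ∀ {P : Set} (d : Dec P) → ¬ P → not ⌊ d ⌋ ≡ true
⌊⌋-complete-¬ (yes p) ¬p = ⊥-elim (¬p p)
⌊⌋-complete-¬ (no _)  _  = refl

without : ∀ {k} → (Fin k → Bool) → Fin k → Fin k → Bool
without Q b a = Q a ∧ not ⌊ a ≟ b ⌋

-- membership in `without Q b a`, stated for the unfolded Boolean
without-elim : ∀ {k} {c : Bool} {a b : Fin k} → c ∧ not ⌊ a ≟ b ⌋ ≡ true → c ≡ true × a ≢ b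
without-elim {a = a} {b} h = proj₁ (∧-elim h) , ⌊⌋-refutes (a ≟ b) (proj₂ (∧-elim h))

without-intro : ∀ {k} {c : Bool} {a b : Fin k} → c ≡ true → a ≢ b → c ∧ not ⌊ a ≟ b ⌋ ≡ true
without-intro {a = a} {b} c a≢b = ∧-intro c (⌊⌋-complete-¬ (a ≟ b) a≢b)

count-cong : ∀ {k} {P Q : Fin k → Bool} → (∀ a → P a ≡ Q a) → count P ≡ count Q
count-cong {zero}  eq = refl
count-cong {suc k} eq rewrite eq zero = cong (_ +_) (count-cong (eq ∘ suc))

count-without : ∀ {k} (Q : Fin k → Bool) {b} → Q b ≡ true → count Q ≡ suc (count (without Q b))
count-without {suc k} Q {zero} Qb rewrite Qb =
  cong suc (count-cong (λ a → sym (∧-identityʳ (Q (suc a)))))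
count-without {suc k} Q {suc b} Qb
  rewrite ∧-identityʳ (Q zero)
        | count-cong {P = without Q (suc b) ∘ suc} {Q = without (Q ∘ suc) b}
            (λ a → cong (λ t → Q (suc a) ∧ not t) (⌊⌋-map′ (cong suc) Fin-suc-injective (a ≟ b)))
        | count-without (Q ∘ suc) Qb = +-suc _ _

count-none : ∀ {k} (Q : Fin k → Bool) → (∀ a → Q a ≡ false) → count Q ≡ 0
count-none {zero}  Q none = refl
count-none {suc k} Q none rewrite none zero = count-none (Q ∘ suc) (none ∘ suc)

count-witness : ∀ {k} (Q : Fin k → Bool) → count Q ≢ 0 → ∃ λ a → Q a ≡ true
count-witness {zero}  Q c≢0 = ⊥-elim (c≢0 refl)
count-witness {suc k} Q c≢0 with Q zero in Q0
... | true  = zero , Q0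
... | false = let (a , Qa) = count-witness (Q ∘ suc) c≢0 in suc a , Qa

count-single : ∀ {k} {Q : Fin k → Bool} {a} → Q a ≡ true → (∀ b → Q b ≡ true → b ≡ a) → count Q ≡ 1
count-single {Q = Q} {a} Qa only = trans (count-without Q Qa) (cong suc (count-none _ removed))
  where
  removed : ∀ b → without Q a b ≡ false
  removed b with Q b in Qb
  ... | false = refl
  ... | true  rewrite ⌊⌋-complete (b ≟ a) (only b Qb) = refl

count-one-unique : ∀ {k} (Q : Fin k → Bool) {a b} → count Q ≡ 1 → Q a ≡ true → Q b ≡ true → a ≡ b
count-one-unique Q {a} {b} one Qa Qb with a ≟ b
... | yes a≡b = a≡b
... | no  a≢b = ⊥-elim (1+n≢0 (trans (sym (count-without (without Q a) b∈)) rest≡0))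
  where
  b∈ : without Q a b ≡ true
  b∈ = without-intro Qb (a≢b ∘ sym)
  rest≡0 : count (without Q a) ≡ 0
  rest≡0 = suc-injective (trans (sym (count-without Q Qa)) one)

record Injection {k l} (P : Fin k → Bool) (Q : Fin l → Bool) : Set where
  field
    map       : ∀ a → P a ≡ true → Fin l
    into      : ∀ a Pa → Q (map a Pa) ≡ true
    injective : ∀ a a′ Pa Pa′ → map a Pa ≡ map a′ Pa′ → a ≡ a′

count-injection : ∀ {k l} {P : Fin k → Bool} {Q : Fin l → Bool} → Injection P Q → count P ≤ count Q
count-injection {zero} f = z≤n
count-injection {suc k} {P = P} {Q} f with P zero in P0
... | false = count-injection shift
  where
  open Injection f
  shift : Injection (P ∘ suc) Q
  shift = record { map = map ∘ suc ; into = into ∘ suc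
                 ; injective = λ a a′ Pa Pa′ → Fin-suc-injective ∘ injective _ _ Pa Pa′ }
... | true = subst (suc (count (P ∘ suc)) ≤_) (sym (count-without Q (into zero P0))) (s≤s (count-injection shift))
  where
  open Injection f
  shift : Injection (P ∘ suc) (without Q (map zero P0))
  shift = record
    { map = map ∘ suc
    ; into = λ a Pa → without-intro (into (suc a) Pa) (λ e → 0≢1+n (sym (injective _ _ Pa P0 e)))
    ; injective = λ a a′ Pa Pa′ → Fin-suc-injective ∘ injective _ _ Pa Pa′ }

injection-onto : ∀ {k l} {P : Fin k → Bool} {Q : Fin l → Bool} (f : Injection P Q) →
  count Q ≤ count P → ∀ {q} → Q q ≡ true → ¬ (∀ a Pa → Injection.map f a Pa ≢ q)
injection-onto {P = P} {Q} f Q≤P {q} Qq missed =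
  1+n≰n (≤-trans (subst (_≤ count P) (count-without Q Qq) Q≤P) (count-injection avoiding))
  where
  open Injection f
  avoiding : Injection P (without Q q)
  avoiding = record { map = map ; into = λ a Pa → without-intro (into a Pa) (missed a Pa) ; injective = injective }

transversal-intro : ∀ {n m} {p : Fin m → Fin n} {S : Fin m → Bool} →
  (∀ v → ∃ λ a → (S a ≡ true × p a ≡ v) × (∀ b → S b ≡ true → p b ≡ v → b ≡ a)) →
  IsTransversal p S
transversal-intro {p = p} pick v =
  let (a , (Sa , pa) , only) = pick v in
  count-single (∧-intro Sa (⌊⌋-complete (p a ≟ v) pa))
    (λ b h → let (Sb , pb) = ∧-elim h in only b Sb (⌊⌋-sound (p b ≟ v) pb))

module Transversal {n m} (p : Fin m → Fin n) {T : Fin m → Bool} (T-transversal : IsTransversal p T) where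

  same-fibre : ∀ {a b} → T a ≡ true → T b ≡ true → p a ≡ p b → a ≡ b
  same-fibre {a} {b} Ta Tb pa≡pb = count-one-unique _ (T-transversal (p a))
    (∧-intro Ta (⌊⌋-complete (p a ≟ p a) refl)) (∧-intro Tb (⌊⌋-complete (p b ≟ p a) (sym pa≡pb)))

  representative : ∀ v → ∃ λ a → T a ≡ true × p a ≡ v
  representative v =
    let (a , h) = count-witness _ (λ c≡0 → 1+n≢0 (trans (sym (T-transversal v)) c≡0))
        (Ta , pa) = ∧-elim h
    in a , Ta , ⌊⌋-sound (p a ≟ v) pa

  swap : Fin m → Fin m → Fin m → Bool
  swap z w a = ⌊ a ≟ w ⌋ ∨ without T z a

  swap-elim : ∀ {z w a} → swap z w a ≡ true → a ≡ w ⊎ (T a ≡ true × a ≢ z)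
  swap-elim {z} {w} {a} h with ∨-elim h
  ... | inj₁ a≡w = inj₁ (⌊⌋-sound (a ≟ w) a≡w)
  ... | inj₂ old = inj₂ (without-elim old)

  swap-old : ∀ {z w a} → swap z w a ≡ true → a ≢ w → T a ≡ true × a ≢ z
  swap-old {z} Sa a≢w with swap-elim {z} Sa
  ... | inj₁ a≡w = ⊥-elim (a≢w a≡w)
  ... | inj₂ old = old

  swap-transversal : ∀ {z w} → T z ≡ true → p w ≡ p z → IsTransversal p (swap z w)
  swap-transversal {z} {w} Tz pw≡pz = transversal-intro pick
    where
    pick : ∀ v → ∃ λ a → (swap z w a ≡ true × p a ≡ v) × (∀ b → swap z w b ≡ true → p b ≡ v → b ≡ a)
    pick v with p z ≟ v
    ... | yes pz≡v = w , (new , trans pw≡pz pz≡v) , only-w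
      where
      new : swap z w w ≡ true
      new rewrite ⌊⌋-complete (w ≟ w) refl = refl
      only-w : ∀ b → swap z w b ≡ true → p b ≡ v → b ≡ w
      only-w b Sb pb≡v with swap-elim {z} Sb
      ... | inj₁ b≡w         = b≡w
      ... | inj₂ (Tb , b≢z) = ⊥-elim (b≢z (same-fibre Tb Tz (trans pb≡v (sym pz≡v))))
    ... | no pz≢v = t , (∨-introʳ (without-intro Tt t≢z) , pt≡v) , only-t
      where
      t  = proj₁ (representative v)
      Tt = proj₁ (proj₂ (representative v))
      pt≡v = proj₂ (proj₂ (representative v))
      t≢z : t ≢ z
      t≢z t≡z = pz≢v (trans (cong p (sym t≡z)) pt≡v)
      only-t : ∀ b → swap z w b ≡ true → p b ≡ v → b ≡ t
      only-t b Sb pb≡v with swap-elim {z} Sb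
      ... | inj₁ b≡w       = ⊥-elim (pz≢v (trans (sym pw≡pz) (trans (cong p (sym b≡w)) pb≡v)))
      ... | inj₂ (Tb , _) = same-fibre Tb Tt (trans pb≡v (sym pt≡v))

open DirectedCycle using (vert)

inject₁-or-last : ∀ {l} (i : Fin (suc l)) → (∃ λ k → i ≡ inject₁ k) ⊎ i ≡ fromℕ l
inject₁-or-last {zero}  zero    = inj₂ refl
inject₁-or-last {suc l} zero    = inj₁ (zero , refl)
inject₁-or-last {suc l} (suc i) with inject₁-or-last i
... | inj₁ (k , i≡k) = inj₁ (suc k , cong suc i≡k)
... | inj₂ i≡last    = inj₂ (cong suc i≡last)

successor : ∀ {m} {G : Digraph m} (C : DirectedCycle G) i → ∃ λ j → Arc G (vert C i) (vert C j)
successor {G = G} C i with inject₁-or-last i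
... | inj₁ (k , i≡k) = suc k , subst (λ a → Arc G (vert C a) (vert C (suc k))) (sym i≡k) (DirectedCycle.step C k)
... | inj₂ i≡last    = zero , subst (λ a → Arc G (vert C a) (vert C zero)) (sym i≡last) (DirectedCycle.close C)

transfer-cycle : ∀ {m} {G G′ : Digraph m} (C : DirectedCycle G) →
  (∀ i j → Arc G (vert C i) (vert C j) → Arc G′ (vert C i) (vert C j)) → DirectedCycle G′
transfer-cycle C lift = record
  { len = len ; vert = vert C ; distinct = distinct ; step = λ k → lift _ _ (step k) ; close = lift _ _ close }
  where open DirectedCycle C hiding (vert)

induced-elim : ∀ {m} {G : Digraph m} {S : Fin m → Bool} {a b} →
  Arc (induced G S) a b → S a ≡ true × S b ≡ true × Arc G a b
induced-elim arc = let (Sa , rest) = ∧-elim arc in Sa , ∧-elim rest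

induced-intro : ∀ {m} {G : Digraph m} {S : Fin m → Bool} {a b} →
  S a ≡ true → S b ≡ true → Arc G a b → Arc (induced G S) a b
induced-intro Sa Sb arc = ∧-intro Sa (∧-intro Sb arc)

cycle-inside : ∀ {m} {G : Digraph m} {S : Fin m → Bool} (C : DirectedCycle (induced G S)) →
  ∀ i → S (vert C i) ≡ true
cycle-inside {G = G} {S} C i = proj₁ (induced-elim {G = G} {S = S} (proj₂ (successor C i)))

arc-survives : ∀ {m} {H : Digraph m} {x y a b} → Arc H a b → a ≢ x ⊎ b ≢ y → Arc (removeArc H x y) a b
arc-survives {x = x} {y} {a} {b} arc avoids rewrite arc with a ≟ x | b ≟ y
... | no _     | _        = refl
... | yes _    | no _     = refl
... | yes a≡x  | yes b≡y  = ⊥-elim ([ (λ a≢x → a≢x a≡x) , (λ b≢y → b≢y b≡y) ] avoids)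

module Exchange
  {n m} {D : Digraph n} {p : Fin m → Fin n} {H : Digraph m}
  (cover : IsCover D p H) (degree-feasible : DegreeFeasible D p) (uncolorable : ¬ Colorable p H)
  {x y : Fin m} {T : Fin m → Bool} (T-transversal : IsTransversal p T)
  (T-acyclic : ¬ DirectedCycle (induced (removeArc H x y) T)) where

  open IsCover cover
  open Transversal p T-transversal

  Endpoint : Fin m → Set
  Endpoint z = z ≡ x ⊎ z ≡ y

  arc-over : ∀ {z w b} → p w ≡ p z → Arc H w b → Arc D (p z) (p b)
  arc-over {b = b} pw≡pz arc = subst (λ v → Arc D v (p b)) pw≡pz (arises _ _ arc)

  cycle-missing-endpoint : ∀ {z S} → Endpoint z → (C : DirectedCycle (induced H S)) →
    (∀ i → T (vert C i) ≡ true × vert C i ≢ z) → ⊥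
  cycle-missing-endpoint {z} {S} endpoint C inside = T-acyclic (transfer-cycle C lift)
    where
    lift : ∀ i j → Arc (induced H S) (vert C i) (vert C j) → Arc (induced (removeArc H x y) T) (vert C i) (vert C j)
    lift i j arc = induced-intro {G = removeArc H x y} {S = T} (proj₁ (inside i)) (proj₁ (inside j))
                     (arc-survives {H = H} (proj₂ (proj₂ (induced-elim {G = H} {S = S} arc))) avoids)
      where
      avoids : vert C i ≢ x ⊎ vert C j ≢ y
      avoids = ⊎-map (λ z≡x i≡x → proj₂ (inside i) (trans i≡x (sym z≡x)))
                     (λ z≡y j≡y → proj₂ (inside j) (trans j≡y (sym z≡y))) endpoint

  -- both endpoints of xy lie in T, for otherwise T would be acyclic in H
  endpoint-in-T : ∀ {z} → Endpoint z → T z ≡ true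
  endpoint-in-T {z} endpoint with T z in Tz
  ... | true  = refl
  ... | false = ⊥-elim (uncolorable (T , T-transversal , λ C →
      cycle-missing-endpoint {S = T} endpoint C (λ i → cycle-inside {S = T} C i , λ i≡z →
        true≢false (trans (sym (cycle-inside {S = T} C i)) (trans (cong T i≡z) Tz)))))
    where
    true≢false : true ≢ false
    true≢false ()

  Exit : Fin m → Fin m → Fin m → Set
  Exit z w b = T b ≡ true × b ≢ z × Arc H w b

  swap-cycle-exit : ∀ {z w} → Endpoint z → (C : DirectedCycle (induced H (swap z w))) →
    ∃ λ j → Exit z w (vert C j)
  swap-cycle-exit {z} {w} endpoint C with any? (λ i → vert C i ≟ w)
  ... | no avoids-w = ⊥-elim (cycle-missing-endpoint {S = swap z w} endpoint C
          (λ i → swap-old {z} (cycle-inside {S = swap z w} C i) (λ i≡w → avoids-w (i , i≡w))))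
  ... | yes (i , i≡w) = let (Tj , j≢z) = swap-old {z} Sj j≢w in j , Tj , j≢z , Hwj
    where
    j = proj₁ (successor C i)
    arc = induced-elim {G = H} {S = swap z w} (proj₂ (successor C i))
    Sj = proj₁ (proj₂ arc)
    Hwj : Arc H w (vert C j)
    Hwj = subst (λ a → Arc H a (vert C j)) i≡w (proj₂ (proj₂ arc))
    j≢w : vert C j ≢ w
    j≢w j≡w = independent _ _ Hwj (cong p (sym j≡w))

  has-exit : ∀ {z w} → Endpoint z → p w ≡ p z → ∃ (Exit z w)
  has-exit {z} {w} endpoint pw≡pz with any? (λ b → (T b ≟ᴮ true) ×-dec (¬? (b ≟ z) ×-dec (H w b ≟ᴮ true)))
  ... | yes found = found
  ... | no  none  = ⊥-elim (uncolorable
          (swap z w , swap-transversal (endpoint-in-T endpoint) pw≡pz ,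
           λ C → none (_ , proj₂ (swap-cycle-exit endpoint C))))

  module ExitMap {z} (endpoint : Endpoint z) where

    exit : ∀ w → p w ≡ p z → Fin m
    exit w pw≡pz = proj₁ (has-exit endpoint pw≡pz)

    exit-spec : ∀ w pw≡pz → Exit z w (exit w pw≡pz)
    exit-spec w pw≡pz = proj₂ (has-exit endpoint pw≡pz)

    -- exit does not depend on the proof that w lies in the fibre (UIP for Fin)
    exit-cong : ∀ {w w′} (pw : p w ≡ p z) (pw′ : p w′ ≡ p z) → w ≡ w′ → exit w pw ≡ exit w′ pw′
    exit-cong pw pw′ refl = cong (exit _) (Decidable⇒UIP.≡-irrelevant _≟_ pw pw′)

    -- w ↦ p (exit w) injects the fibre of z into the out-neighbourhood of p z,
    -- because arcs of H into the fibre of a vertex of T form a matching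
    exit-injection : Injection (λ a → ⌊ p a ≟ p z ⌋) (D (p z))
    exit-injection = record
      { map = λ a Pa → p (exit a (⌊⌋-sound (p a ≟ p z) Pa))
      ; into = λ a Pa → arc-over (⌊⌋-sound (p a ≟ p z) Pa) (proj₂ (proj₂ (exit-spec a _)))
      ; injective = λ a a′ Pa Pa′ e →
          let (Tb , _ , Hab) = exit-spec a (⌊⌋-sound (p a ≟ p z) Pa)
              (Tb′ , _ , Ha′b′) = exit-spec a′ (⌊⌋-sound (p a′ ≟ p z) Pa′)
          in matching-in a a′ _ (subst (Arc H a) (same-fibre Tb Tb′ e) Hab) Ha′b′
               (trans (⌊⌋-sound (p a ≟ p z) Pa) (sym (⌊⌋-sound (p a′ ≟ p z) Pa′))) }

    -- by degree feasibility |X_{p z}| ≥ d⁺(p z), so the injection is onto: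
    -- every vertex of T over an out-neighbour of p z is an exit
    exit-onto : ∀ {t} → T t ≡ true → Arc D (p z) (p t) →
      ¬ ¬ (∃ λ w → Σ (p w ≡ p z) λ pw≡pz → exit w pw≡pz ≡ t)
    exit-onto Tt arc no-preimage =
      injection-onto exit-injection (≤-trans (m≤m⊔n _ _) (degree-feasible (p z))) arc
        (λ a Pa e → no-preimage (a , _ , same-fibre (proj₁ (exit-spec a _)) Tt e))

    in-neighbour : ∀ {t} → T t ≡ true → Arc D (p z) (p t) → ¬ ¬ (∃ λ w → p w ≡ p z × Arc H w t)
    in-neighbour Tt arc none = exit-onto Tt arc λ (w , pw≡pz , exit≡t) →
      none (w , pw≡pz , subst (Arc H w) exit≡t (proj₂ (proj₂ (exit-spec w pw≡pz))))

    unique-out-neighbour : ∀ {w b₁ b₂} → p w ≡ p z → T b₁ ≡ true → T b₂ ≡ true →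
      Arc H w b₁ → Arc H w b₂ → b₁ ≡ b₂
    unique-out-neighbour {w} {b₁} {b₂} pw≡pz Tb₁ Tb₂ Hwb₁ Hwb₂ =
      decidable-stable (b₁ ≟ b₂) λ b₁≢b₂ →
        exit-onto Tb₁ (arc-over pw≡pz Hwb₁) λ (w₁ , pw₁ , exit₁≡b₁) →
        exit-onto Tb₂ (arc-over pw≡pz Hwb₂) λ (w₂ , pw₂ , exit₂≡b₂) →
        b₁≢b₂ (begin
          b₁           ≡⟨ sym exit₁≡b₁ ⟩
          exit w₁ pw₁  ≡⟨ exit-cong pw₁ pw₂ (trans (is-w exit₁≡b₁ Hwb₁) (sym (is-w exit₂≡b₂ Hwb₂))) ⟩
          exit w₂ pw₂  ≡⟨ exit₂≡b₂ ⟩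
          b₂           ∎)
      where
      open ≡-Reasoning
      is-w : ∀ {w′ b} {pw′ : p w′ ≡ p z} → exit w′ pw′ ≡ b → Arc H w b → w′ ≡ w
      is-w {w′} {pw′ = pw′} exit≡b Hwb =
        matching-in w′ w _ (subst (Arc H w′) exit≡b (proj₂ (proj₂ (exit-spec w′ pw′)))) Hwb (trans pw′ (sym pw≡pz))

  -- Some y′ ∈ X_{p y} has y′x ∈ H; in T with y exchanged
  -- for y′, a cycle must run y′ → x → c, and neither c = y′ (matching at x)
  -- nor c ∈ T (x's only out-neighbour in T is y) is possible.
  reverse-arc-present : Arc H x y → Arc D (p y) (p x) → H y x ≡ false → ⊥
  reverse-arc-present Hxy Dyx Hyx≡false = Y.in-neighbour Tx Dyx no-in-neighbour
    where
    module X = ExitMap {x} (inj₁ refl)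
    module Y = ExitMap {y} (inj₂ refl)
    Tx = endpoint-in-T (inj₁ refl)
    Ty = endpoint-in-T (inj₂ refl)

    no-in-neighbour : (∃ λ y′ → p y′ ≡ p y × Arc H y′ x) → ⊥
    no-in-neighbour (y′ , py′≡py , Hy′x) =
      uncolorable (swap y y′ , swap-transversal Ty py′≡py , no-cycle)
      where
      y≢y′ : y ≢ y′
      y≢y′ refl with trans (sym Hy′x) Hyx≡false
      ... | ()

      no-cycle : ¬ DirectedCycle (induced H (swap y y′))
      no-cycle C = successor-impossible (swap-elim {y} Sc)
        where
        j = proj₁ (swap-cycle-exit (inj₂ refl) C)
        a = vert C j
        exit-a : Exit y y′ a
        exit-a = proj₂ (swap-cycle-exit (inj₂ refl) C)
        -- the cycle leaves y′ towards x, the only out-neighbour of y′ in T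
        x≡a : x ≡ a
        x≡a = Y.unique-out-neighbour py′≡py Tx (proj₁ exit-a) Hy′x (proj₂ (proj₂ exit-a))
        c = vert C (proj₁ (successor C j))
        x→c = induced-elim {G = H} {S = swap y y′} (proj₂ (successor C j))
        Sc : swap y y′ c ≡ true
        Sc = proj₁ (proj₂ x→c)
        Hxc : Arc H x c
        Hxc = subst (λ b → Arc H b c) (sym x≡a) (proj₂ (proj₂ x→c))
        -- and then continues from x to c, which is neither y′ nor in T
        successor-impossible : c ≡ y′ ⊎ (T c ≡ true × c ≢ y) → ⊥
        successor-impossible (inj₁ c≡y′) =
          y≢y′ (matching-out x y y′ Hxy (subst (Arc H x) c≡y′ Hxc) (sym py′≡py))
        successor-impossible (inj₂ (Tc , c≢y)) =
          c≢y (sym (X.unique-out-neighbour refl Ty Tc Hxy Hxc))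

reverse-arc : ∀ {n m} {D : Digraph n} {p : Fin m → Fin n} {H : Digraph m} →
  IsCover D p H → DegreeFeasible D p → MinimalUncolorable p H →
  ∀ {x y} → Arc D (p y) (p x) → Arc H x y → Arc H y x
reverse-arc {H = H} cover degree-feasible (uncolorable , minimal) {x} {y} Dyx Hxy with H y x in Hyx
... | true  = refl
... | false =
  let (T , T-transversal , T-acyclic) = minimal x y Hxy
  in ⊥-elim (Exchange.reverse-arc-present cover degree-feasible uncolorable T-transversal T-acyclic Hxy Dyx Hyx)

proposition12 : ∀ {n m} (D : Digraph n) (p : Fin m → Fin n) (H : Digraph m) →
    FeasibleConfiguration D p H → DegreeFeasible D p → MinimalUncolorable p H →
    ∀ u v → Arc D u v → Arc D v u →
    ∀ x y → (p x ≡ u ⊎ p x ≡ v) → (p y ≡ u ⊎ p y ≡ v) →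
    Arc H x y → Arc H y x
proposition12 D p H (_ , _ , cover) degree-feasible minimal u v Duv Dvu x y px py Hxy =
  reverse-arc cover degree-feasible minimal (digon-arc px py) Hxy
  where
  -- X_u and X_v are independent, so x and y lie over different ends of the
  -- digon and D contains the arc p y → p x
  digon-arc : (p x ≡ u ⊎ p x ≡ v) → (p y ≡ u ⊎ p y ≡ v) → Arc D (p y) (p x)
  digon-arc (inj₁ px≡u) (inj₂ py≡v) = subst₂ (Arc D) (sym py≡v) (sym px≡u) Dvu
  digon-arc (inj₂ px≡v) (inj₁ py≡u) = subst₂ (Arc D) (sym py≡u) (sym px≡v) Duv
  digon-arc (inj₁ px≡u) (inj₁ py≡u) = ⊥-elim (IsCover.independent cover x y Hxy (trans px≡u (sym py≡u)))
  digon-arc (inj₂ px≡v) (inj₂ py≡v) = ⊥-elim (IsCover.independent cover x y Hxy (trans px≡v (sym py≡v)))
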